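{- Let $X=\{(2^m,2^k): m,k\geq 0 \text{ integers}\}\subseteq\mathbb{N}^2$ and $E=\{(a,b)\in\mathbb{N}^2: b\leq\log_2 a\}\cup\{(a,b)\in\mathbb{N}^2: a\leq \log_2 b\}$. Then $\mathbb{N}^2\setminus E\subseteq FS(X)$.
   Context: $\mathbb{N}=\{1,2,\dots\}$. For $X\subseteq\mathbb{N}^2$, $FS(X)$ is the set of all finite sums of distinct elements of $X$. -}

module Defs where

open import Data.Nat using (ℕ; zero; suc; _+_; _^_; _≤_)
open import Data.Product using (_×_; _,_; ∃-syntax; Σ-syntax)
open import Data.Sum using (_⊎_)
open import Data.List using (List; []; _∷_; foldr)
open import Data.List.Relation.Unary.All using (All)
open import Data.List.Relation.Unary.Unique.Propositional using (Unique)
open import Relation.Binary.PropositionalEquality using (_≡_; _≢_)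
open import Relation.Nullary using (¬_)

-- A point of ℕ² with ℕ = {1,2,...}
Pos : ℕ → Set
Pos n = 1 ≤ n

ℕ²⁺ : ℕ × ℕ → Set
ℕ²⁺ (a , b) = Pos a × Pos b

_⊕_ : ℕ × ℕ → ℕ × ℕ → ℕ × ℕ
(a , b) ⊕ (c , d) = (a + c , b + d)

sumPairs : List (ℕ × ℕ) → ℕ × ℕ
sumPairs = foldr _⊕_ (0 , 0)

FS : (ℕ × ℕ → Set) → ℕ × ℕ → Set
FS X p = Σ[ xs ∈ List (ℕ × ℕ) ] (xs ≢ [] × All X xs × Unique xs × sumPairs xs ≡ p)

Xpow : ℕ × ℕ → Set
Xpow p = ∃[ m ] ∃[ k ] p ≡ (2 ^ m , 2 ^ k)

-- For naturals, b ≤ log₂ a  ⇔  2^b ≤ a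
E : ℕ × ℕ → Set
E (a , b) = (2 ^ b ≤ a) ⊎ (2 ^ a ≤ b)

{-# OPTIONS --safe #-}
-- Write a = Σ 2^mᵢ and b = Σ 2^kⱼ in binary. Since a < 2^b, a has at most b
-- binary digits, and likewise b has at most a. Say a has no more digits than
-- b. As long as a list of powers of two is shorter than its sum, one of its
-- terms 2^(e+1) can be split into 2^e + 2^e, so a can be written as a sum of
-- exactly as many (not necessarily distinct) powers of two as b has binary
-- digits. Pairing these terms with the digits of b gives pairs in X that are
-- distinct because their second coordinates are.
module Submission where

open import Defs
open import Data.Empty using (⊥-elim)
open import Data.List using (List; []; _∷_; length; map; zip)
open import Data.List.Relation.Unary.All as All using (All; []; _∷_)
import Data.List.Relation.Unary.All.Properties as All
open import Data.List.Relation.Unary.AllPairs using ([]; _∷_)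
open import Data.List.Relation.Unary.Unique.Propositional using (Unique)
import Data.List.Relation.Unary.Unique.Propositional.Properties as Unique
open import Data.Nat using (ℕ; suc; _+_; _∸_; _^_; _≤_; _<_; _≤′_; ≤′-refl; ≤′-step; s≤s; _≤?_; NonZero)
open import Data.Nat.ListAction using (sum)
open import Data.Nat.Properties
open import Data.Product using (_×_; _,_; ∃-syntax; proj₁; proj₂; swap)
open import Data.Sum using (inj₁; inj₂)
open import Function using (_∘_)
open import Relation.Binary.PropositionalEquality
open import Relation.Nullary using (¬_; yes; no)

IsPowerOfTwo : ℕ → Set
IsPowerOfTwo n = ∃[ e ] n ≡ 2 ^ e

All-≤-sum : ∀ xs → All (_≤ sum xs) xs
All-≤-sum []       = []
All-≤-sum (x ∷ xs) =
  m≤m+n x (sum xs) ∷ All.map (λ y≤ → ≤-trans y≤ (m≤n+m (sum xs) x)) (All-≤-sum xs)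

binary-expansion : ∀ N x → x < 2 ^ N →
  ∃[ xs ] All IsPowerOfTwo xs × Unique xs × length xs ≤ N × sum xs ≡ x
binary-expansion 0       0       _         = [] , [] , [] , ≤-refl , refl
binary-expansion 0       (suc _) (s≤s ())
binary-expansion (suc N) x x<2^[1+N] with 2 ^ N ≤? x
... | no 2^N≰x =
  let xs , pow , uniq , len , sum≡ = binary-expansion N x (≰⇒> 2^N≰x)
  in  xs , pow , uniq , m≤n⇒m≤1+n len , sum≡
... | yes 2^N≤x =
  let xs , pow , uniq , len , sum≡ = binary-expansion N r r<2^N
  in  2 ^ N ∷ xs , (N , refl) ∷ pow ,
      All.map distinct (subst (λ s → All (_≤ s) xs) sum≡ (All-≤-sum xs)) ∷ uniq ,
      s≤s len , trans (cong (2 ^ N +_) sum≡) (m+[n∸m]≡n 2^N≤x)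
  where
  instance
    2^N≢0 : NonZero (2 ^ N)
    2^N≢0 = m^n≢0 2 N
  r : ℕ
  r = x ∸ 2 ^ N
  r<2^N : r < 2 ^ N
  r<2^N = m<n+o⇒m∸n<o x (2 ^ N)
            (subst (x <_) (cong (2 ^ N +_) (+-identityʳ (2 ^ N))) x<2^[1+N])
  distinct : ∀ {y} → y ≤ r → 2 ^ N ≢ y
  distinct y≤r refl = <-irrefl refl (≤-<-trans y≤r r<2^N)

SumOfPowersOfTwo : ℕ → ℕ → Set
SumOfPowersOfTwo k n = ∃[ xs ] All IsPowerOfTwo xs × length xs ≡ k × sum xs ≡ n

split-power : ∀ xs → All IsPowerOfTwo xs → length xs < sum xs →
  SumOfPowersOfTwo (suc (length xs)) (sum xs)
split-power (_ ∷ xs) ((0 , refl) ∷ pow) (s≤s len<sum) =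
  let ys , pow′ , len≡ , sum≡ = split-power xs pow len<sum
  in  1 ∷ ys , (0 , refl) ∷ pow′ , cong suc len≡ , cong suc sum≡
split-power (_ ∷ xs) ((suc e , refl) ∷ pow) _ =
  2 ^ e ∷ 2 ^ e ∷ xs , (e , refl) ∷ (e , refl) ∷ pow , refl , halves
  where
  halves : 2 ^ e + (2 ^ e + sum xs) ≡ 2 ^ suc e + sum xs
  halves = begin
    2 ^ e + (2 ^ e + sum xs)   ≡⟨ +-assoc (2 ^ e) (2 ^ e) (sum xs) ⟨
    (2 ^ e + 2 ^ e) + sum xs   ≡⟨ cong (λ m → 2 ^ e + m + sum xs) (+-identityʳ (2 ^ e)) ⟨
    2 ^ suc e + sum xs         ∎
    where open ≡-Reasoning

SumOfPowersOfTwo-suc : ∀ {k n} → SumOfPowersOfTwo k n → k < n → SumOfPowersOfTwo (suc k) n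
SumOfPowersOfTwo-suc (xs , pow , refl , refl) = split-power xs pow

SumOfPowersOfTwo-mono : ∀ {k l n} → SumOfPowersOfTwo k n → k ≤ l → l ≤ n → SumOfPowersOfTwo l n
SumOfPowersOfTwo-mono {k} {n = n} s k≤l = go (≤⇒≤′ k≤l)
  where
  go : ∀ {l} → k ≤′ l → l ≤ n → SumOfPowersOfTwo l n
  go ≤′-refl        _   = s
  go (≤′-step k≤′l) l<n = SumOfPowersOfTwo-suc (go k≤′l (<⇒≤ l<n)) l<n

map-proj₁-zip : ∀ {A B : Set} (xs : List A) (ys : List B) →
  length xs ≡ length ys → map proj₁ (zip xs ys) ≡ xs
map-proj₁-zip []       []       _   = refl
map-proj₁-zip (x ∷ xs) (y ∷ ys) len = cong (x ∷_) (map-proj₁-zip xs ys (suc-injective len))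

map-proj₂-zip : ∀ {A B : Set} (xs : List A) (ys : List B) →
  length xs ≡ length ys → map proj₂ (zip xs ys) ≡ ys
map-proj₂-zip []       []       _   = refl
map-proj₂-zip (x ∷ xs) (y ∷ ys) len = cong (y ∷_) (map-proj₂-zip xs ys (suc-injective len))

sumPairs-proj : ∀ ps → sumPairs ps ≡ (sum (map proj₁ ps) , sum (map proj₂ ps))
sumPairs-proj []       = refl
sumPairs-proj (p ∷ ps) = cong (p ⊕_) (sumPairs-proj ps)

sumPairs-swap : ∀ ps → sumPairs (map swap ps) ≡ swap (sumPairs ps)
sumPairs-swap []       = refl
sumPairs-swap (p ∷ ps) = cong (swap p ⊕_) (sumPairs-swap ps)

FS-swap : ∀ {X} → (∀ {p} → X p → X (swap p)) → ∀ {p} → FS X p → FS X (swap p)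
FS-swap X-swap ([]         , ps≢[] , _) = ⊥-elim (ps≢[] refl)
FS-swap X-swap (ps@(_ ∷ _) , _ , X-ps , uniq , refl) =
  map swap ps , (λ ()) , All.map⁺ (All.map X-swap X-ps) , Unique.map⁺ (cong swap) uniq ,
  sumPairs-swap ps

Xpow-swap : ∀ {p} → Xpow p → Xpow (swap p)
Xpow-swap (m , k , refl) = k , m , refl

FS-zip : ∀ xs ys → All IsPowerOfTwo xs → All IsPowerOfTwo ys → Unique ys →
  length xs ≡ length ys → ys ≢ [] → FS Xpow (sum xs , sum ys)
FS-zip xs ys pow-xs pow-ys uniq len ys≢[] =
  zip xs ys , zip≢[] , All.zipWith pair-Xpow (pow₁ , pow₂) ,
  Unique.map⁻ (subst Unique (sym proj₂≡) uniq) , sum≡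
  where
  proj₁≡ : map proj₁ (zip xs ys) ≡ xs
  proj₁≡ = map-proj₁-zip xs ys len
  proj₂≡ : map proj₂ (zip xs ys) ≡ ys
  proj₂≡ = map-proj₂-zip xs ys len
  pow₁ : All (IsPowerOfTwo ∘ proj₁) (zip xs ys)
  pow₁ = All.map⁻ (subst (All IsPowerOfTwo) (sym proj₁≡) pow-xs)
  pow₂ : All (IsPowerOfTwo ∘ proj₂) (zip xs ys)
  pow₂ = All.map⁻ (subst (All IsPowerOfTwo) (sym proj₂≡) pow-ys)
  pair-Xpow : ∀ {p} → IsPowerOfTwo (proj₁ p) × IsPowerOfTwo (proj₂ p) → Xpow p
  pair-Xpow ((m , refl) , (k , refl)) = m , k , refl
  zip≢[] : zip xs ys ≢ []
  zip≢[] zip≡[] = ys≢[] (trans (sym proj₂≡) (cong (map proj₂) zip≡[]))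
  sum≡ : sumPairs (zip xs ys) ≡ (sum xs , sum ys)
  sum≡ = trans (sumPairs-proj (zip xs ys)) (cong₂ (λ as bs → sum as , sum bs) proj₁≡ proj₂≡)

FS-refine-zip : ∀ xs ys → All IsPowerOfTwo xs → All IsPowerOfTwo ys → Unique ys →
  0 < sum ys → length xs ≤ length ys → length ys ≤ sum xs → FS Xpow (sum xs , sum ys)
FS-refine-zip _  []          _      _      _    ()
FS-refine-zip xs ys@(_ ∷ _) pow-xs pow-ys uniq _ |xs|≤|ys| |ys|≤sum
  with SumOfPowersOfTwo-mono (xs , pow-xs , refl , refl) |xs|≤|ys| |ys|≤sum
... | zs , pow-zs , len , sum≡ =
  subst (λ a → FS Xpow (a , sum ys)) sum≡ (FS-zip zs ys pow-zs pow-ys uniq len (λ ()))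

proposition3p1 : (a b : ℕ) → ℕ²⁺ (a , b) → ¬ E (a , b) → FS Xpow (a , b)
proposition3p1 a b (a>0 , b>0) ∉E
  with binary-expansion b a (≰⇒> (∉E ∘ inj₁)) | binary-expansion a b (≰⇒> (∉E ∘ inj₂))
... | xs , pow-xs , uniq-xs , |xs|≤b , refl | ys , pow-ys , uniq-ys , |ys|≤a , refl
  with ≤-total (length xs) (length ys)
... | inj₁ |xs|≤|ys| = FS-refine-zip xs ys pow-xs pow-ys uniq-ys b>0 |xs|≤|ys| |ys|≤a
... | inj₂ |ys|≤|xs| =
  FS-swap Xpow-swap (FS-refine-zip ys xs pow-ys pow-xs uniq-xs a>0 |ys|≤|xs| |xs|≤b)
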